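{- There is an absolute constant $c>0$ such that for all integers $n\ge1$ and $3\le w\le n/10$, there exists a length-$n$ width-$w$ read-once branching program over alphabet $\{0,1\}$ that computes $\mathsf{ApproxCount}[n,\Delta]$ for some $\Delta\le n/2-c\sqrt{nw}$.
   Context: A length-$n$ read-once branching program (ROBP) over a finite alphabet $\Sigma$ is a directed layered multigraph with layers $V_0,\dots,V_n$, $V_0=\{v_{\mathrm{start}}\}$; for $0\le i\le n-1$ each vertex of $V_i$ has $|\Sigma|$ outgoing edges into $V_{i+1}$ labeled by distinct elements of $\Sigma$; vertices of $V_n$ are labeled with outputs; every vertex is reachable by some input. An input follows from $v_{\mathrm{start}}$ the edges labeled $x_1,\dots,x_n$ and the program outputs the label of the final vertex. Width is $\max_i|V_i|$. $\mathsf{ApproxCount}[n,\Delta]$: on input $x\in\{0,1\}^n$ output a real $\hat S$ with $|\hat S-\sum_{i=1}^n x_i|\le\Delta$; a program computes it if its output is valid on every input. -}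

module Defs where

open import Data.Nat as ℕ using (ℕ; zero; suc; _<_; _≤_)
open import Data.Nat.Properties using (<⇒≤; ≤-refl)
open import Data.Fin using (Fin; zero; fromℕ<)
open import Data.Bool using (Bool; true; false)
open import Data.Vec using (Vec; []; _∷_; lookup)
open import Data.Integer using (+_)
open import Data.Rational as ℚ using (ℚ; ∣_∣; _-_; _/_)
open import Data.Product using (Σ; ∃; _×_)
open import Relation.Binary.PropositionalEquality using (_≡_)

ℕ→ℚ : ℕ → ℚ
ℕ→ℚ n = + n / 1

-- Layer sizes: |V_0| = 1 (forced), |V_(i+1)| = sizes i.
-- Vertices of layer i are Fin (|V_i|); layer 0 = {start} = {zero}.
-- step i v b = endpoint of the edge labelled b leaving v ∈ V_i (i < n);
-- this is exactly a layered multigraph with one out-edge per symbol.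
-- layer sizes from the sizes of layers 1,2,...; layer 0 has size 1
layerOf : (ℕ → ℕ) → ℕ → ℕ
layerOf s zero    = 1
layerOf s (suc i) = s i

record ROBP (n : ℕ) : Set where
  field
    sizes : ℕ → ℕ
    step : (i : ℕ) → i < n → Fin (layerOf sizes i) → Bool → Fin (sizes i)
    out  : Fin (layerOf sizes n) → ℚ

  layer : ℕ → ℕ
  layer = layerOf sizes

  run : (i : ℕ) → i ≤ n → Vec Bool n → Fin (layer i)
  run zero    _ x = zero
  run (suc i) p x = step i p (run i (<⇒≤ p) x) (lookup x (fromℕ< p))

  eval : Vec Bool n → ℚ
  eval x = out (run n ≤-refl x)

open ROBP public

AllReachable : ∀ {n} → ROBP n → Set
AllReachable {n} P =
  ∀ (i : ℕ) (p : i ≤ n) (v : Fin (layer P i)) → ∃ λ (x : Vec Bool n) → run P i p x ≡ v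

HasWidth : ∀ {n} → ROBP n → ℕ → Set
HasWidth {n} P w =
  (∀ (i : ℕ) → i ≤ n → layer P i ≤ w) × (Σ ℕ λ i → i ≤ n × layer P i ≡ w)

count : ∀ {n} → Vec Bool n → ℕ
count []           = 0
count (true  ∷ xs) = suc (count xs)
count (false ∷ xs) = count xs

ComputesApproxCount : ∀ {n} → ROBP n → ℚ → Set
ComputesApproxCount {n} P Δ = ∀ (x : Vec Bool n) → ∣ eval P x - ℕ→ℚ (count x) ∣ ℚ.≤ Δ

-- Δ ≤ n/2 - c·√(n·w), written without square roots:
-- with D = n/2 - Δ, the condition is 0 ≤ D and c²·n·w ≤ D²  (valid for c ≥ 0).
SqrtBound : ℚ → ℕ → ℕ → ℚ → Set
SqrtBound c n w Δ =
  let D = ℕ→ℚ n ℚ.* ℚ.½ - Δ in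
  (ℚ.0ℚ ℚ.≤ D) × (c ℚ.* c ℚ.* ℕ→ℚ n ℚ.* ℕ→ℚ w ℚ.≤ D ℚ.* D)

module Submission where

-- Cut the input into blocks of length b = z + E, where w = z + 2. Inside a block the program
-- counts zeros, capped at z; a block that ends with fewer than z zeros contains more than E ones,
-- and the program then moves to an absorbing state high. Writing n = 2h + F with F ∈ {E, E + 1},
-- it outputs h + F from high and h otherwise. Reaching high certifies count ≥ E + 1 ≥ F, so
-- |h + F − count| ≤ h. Otherwise every complete block had at least z zeros; as E = (1 + k) z and
-- (2 + k) b ≤ n, there are at least 2 + k complete blocks, hence at least (2 + k) z = b ≥ F zeros
-- and count ≤ 2h. So Δ = h = n/2 − F/2, and choosing k maximal makes n < (3 + k)² z, which gives
-- F² ≥ E² ≥ (4/121) n w. Layer i holds exactly the reachable states, the counters up to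
-- min(i mod b, z) and, after the first block, high; so the width is z + 2.

open import Defs
open import Data.Nat
  using (ℕ; zero; suc; _+_; _*_; _∸_; _⊓_; _<_; _≤_; z≤n; s≤s; _<?_; _≤?_; _≟_; _≡ᵇ_; ∣_-_∣)
open import Data.Nat.Properties
open import Data.Nat.DivMod using (_/_; _%_; m≡m%n+[m/n]*n; m%n<n)
open import Data.Nat.Coprimality using (1-coprimeTo) renaming (sym to coprime-sym)
open import Data.Nat.Solver using (module +-*-Solver)
import Data.Integer as ℤ
import Data.Integer.Properties as ℤ
open import Data.Rational as ℚ using (ℚ; mkℚ; 0ℚ)
import Data.Rational.Properties as ℚ
import Data.Rational.Solver as ℚ-Solver
open import Data.Bool using (Bool; true; false; if_then_else_; T)
open import Data.Unit using (tt)
open import Data.Empty using (⊥-elim)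
open import Data.Fin as Fin using (Fin; toℕ; fromℕ<)
import Data.Fin.Properties as Fin
open import Data.Vec using (Vec; []; _∷_; lookup; replicate)
open import Data.Product using (Σ; ∃; ∃₂; _×_; _,_)
open import Data.Sum using (inj₁; inj₂)
open import Relation.Nullary using (¬_; Dec; yes; no)
open import Relation.Binary.PropositionalEquality

ℕ→ℚ≡mkℚ : ∀ n → ℕ→ℚ n ≡ mkℚ (ℤ.+ n) 0 (coprime-sym (1-coprimeTo n))
ℕ→ℚ≡mkℚ n = ℚ.normalize-coprime (coprime-sym (1-coprimeTo n))

ℕ→ℚ-+ : ∀ m n → ℕ→ℚ (m + n) ≡ ℕ→ℚ m ℚ.+ ℕ→ℚ n
ℕ→ℚ-+ m n rewrite ℕ→ℚ≡mkℚ m | ℕ→ℚ≡mkℚ n =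
  cong (ℚ._/ 1) (sym (cong₂ ℤ._+_ (ℤ.*-identityʳ (ℤ.+ m)) (ℤ.*-identityʳ (ℤ.+ n))))

ℕ→ℚ-* : ∀ m n → ℕ→ℚ (m * n) ≡ ℕ→ℚ m ℚ.* ℕ→ℚ n
ℕ→ℚ-* m n rewrite ℕ→ℚ≡mkℚ m | ℕ→ℚ≡mkℚ n = cong (ℚ._/ 1) (ℤ.pos-* m n)

ℕ→ℚ-mono-≤ : ∀ {m n} → m ≤ n → ℕ→ℚ m ℚ.≤ ℕ→ℚ n
ℕ→ℚ-mono-≤ {m} {n} m≤n rewrite ℕ→ℚ≡mkℚ m | ℕ→ℚ≡mkℚ n =
  ℚ.*≤* (subst₂ ℤ._≤_ (sym (ℤ.*-identityʳ (ℤ.+ m))) (sym (ℤ.*-identityʳ (ℤ.+ n))) (ℤ.+≤+ m≤n))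

∣ℕ→ℚ∣ : ∀ n → ℚ.∣ ℕ→ℚ n ∣ ≡ ℕ→ℚ n
∣ℕ→ℚ∣ n rewrite ℕ→ℚ≡mkℚ n = refl

ℕ→ℚ[m+n]-ℕ→ℚm : ∀ m n → ℕ→ℚ (m + n) ℚ.- ℕ→ℚ m ≡ ℕ→ℚ n
ℕ→ℚ[m+n]-ℕ→ℚm m n rewrite ℕ→ℚ-+ m n =
  solve 2 (λ x y → (x :+ y) :- x := y) refl (ℕ→ℚ m) (ℕ→ℚ n)
  where open ℚ-Solver.+-*-Solver

ℕ→ℚm-ℕ→ℚ[m+n] : ∀ m n → ℕ→ℚ m ℚ.- ℕ→ℚ (m + n) ≡ ℚ.- ℕ→ℚ n
ℕ→ℚm-ℕ→ℚ[m+n] m n rewrite ℕ→ℚ-+ m n =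
  solve 2 (λ x y → x :- (x :+ y) := :- y) refl (ℕ→ℚ m) (ℕ→ℚ n)
  where open ℚ-Solver.+-*-Solver

∣ℕ→ℚ-ℕ→ℚ∣ : ∀ m n → ℚ.∣ ℕ→ℚ m ℚ.- ℕ→ℚ n ∣ ≡ ℕ→ℚ ∣ m - n ∣
∣ℕ→ℚ-ℕ→ℚ∣ m n with ≤-total m n
... | inj₁ m≤n with m≤n⇒∃[o]m+o≡n m≤n
...   | d , refl = begin
  ℚ.∣ ℕ→ℚ m ℚ.- ℕ→ℚ (m + d) ∣  ≡⟨ cong ℚ.∣_∣ (ℕ→ℚm-ℕ→ℚ[m+n] m d) ⟩
  ℚ.∣ ℚ.- ℕ→ℚ d ∣              ≡⟨ ℚ.∣-p∣≡∣p∣ (ℕ→ℚ d) ⟩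
  ℚ.∣ ℕ→ℚ d ∣                  ≡⟨ ∣ℕ→ℚ∣ d ⟩
  ℕ→ℚ d                        ≡⟨ cong ℕ→ℚ (∣m-m+n∣≡n m d) ⟨
  ℕ→ℚ ∣ m - m + d ∣            ∎
  where open ≡-Reasoning
∣ℕ→ℚ-ℕ→ℚ∣ m n | inj₂ n≤m with m≤n⇒∃[o]m+o≡n n≤m
...   | d , refl = begin
  ℚ.∣ ℕ→ℚ (n + d) ℚ.- ℕ→ℚ n ∣  ≡⟨ cong ℚ.∣_∣ (ℕ→ℚ[m+n]-ℕ→ℚm n d) ⟩
  ℚ.∣ ℕ→ℚ d ∣                  ≡⟨ ∣ℕ→ℚ∣ d ⟩
  ℕ→ℚ d                        ≡⟨ cong ℕ→ℚ (trans (∣-∣-comm (n + d) n) (∣m-m+n∣≡n n d)) ⟨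
  ℕ→ℚ ∣ n + d - n ∣            ∎
  where open ≡-Reasoning

∣m-n∣≤o : ∀ {m n o} → m ≤ n + o → n ≤ m + o → ∣ m - n ∣ ≤ o
∣m-n∣≤o {m} {n} m≤n+o n≤m+o with ∣m-n∣≡[m∸n]∨[n∸m] m n
... | inj₁ eq = subst (_≤ _) (sym eq) (m≤n+o⇒m∸n≤o m n m≤n+o)
... | inj₂ eq = subst (_≤ _) (sym eq) (m≤n+o⇒m∸n≤o n m n≤m+o)

ones zeros : (ℕ → Bool) → ℕ → ℕ
ones g zero = 0
ones g (suc i) = if g i then suc (ones g i) else ones g i
zeros g zero = 0
zeros g (suc i) = if g i then zeros g i else suc (zeros g i)

ones+zeros : ∀ g i → ones g i + zeros g i ≡ i
ones+zeros g zero = refl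
ones+zeros g (suc i) with g i
... | true = cong suc (ones+zeros g i)
... | false = trans (+-suc (ones g i) (zeros g i)) (cong suc (ones+zeros g i))

ones-≤-suc : ∀ g i → ones g i ≤ ones g (suc i)
ones-≤-suc g i with g i
... | true  = n≤1+n _
... | false = ≤-refl

ones≤length : ∀ g i → ones g i ≤ i
ones≤length g i = subst (ones g i ≤_) (ones+zeros g i) (m≤m+n (ones g i) (zeros g i))

bit : ∀ {n} → Vec Bool n → ℕ → Bool
bit [] _ = false
bit (b ∷ xs) zero = b
bit (b ∷ xs) (suc j) = bit xs j

setBit : ∀ {n} → Vec Bool n → ℕ → Bool → Vec Bool n
setBit [] _ _ = []
setBit (b ∷ xs) zero y = y ∷ xs
setBit (b ∷ xs) (suc j) y = b ∷ setBit xs j y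

lookup≡bit : ∀ {n} (x : Vec Bool n) i (i<n : i < n) → lookup x (fromℕ< i<n) ≡ bit x i
lookup≡bit (b ∷ xs) zero i<n = refl
lookup≡bit (b ∷ xs) (suc i) (s≤s i<n) = lookup≡bit xs i i<n

bit-setBit : ∀ {n} (x : Vec Bool n) i y → i < n → bit (setBit x i y) i ≡ y
bit-setBit (b ∷ xs) zero y _ = refl
bit-setBit (b ∷ xs) (suc i) y (s≤s i<n) = bit-setBit xs i y i<n

bit-setBit-< : ∀ {n} (x : Vec Bool n) i y {j} → j < i → bit (setBit x i y) j ≡ bit x j
bit-setBit-< [] i y j<i = refl
bit-setBit-< (b ∷ xs) (suc i) y {zero} j<i = refl
bit-setBit-< (b ∷ xs) (suc i) y {suc j} (s≤s j<i) = bit-setBit-< xs i y j<i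

ones-shift : ∀ g i → ones g (suc i) ≡ ones (λ j → g (suc j)) i + ones g 1
ones-shift g zero = refl
ones-shift g (suc i) with g (suc i)
... | true = cong suc (ones-shift g i)
... | false = ones-shift g i

count≡ones : ∀ {n} (x : Vec Bool n) → count x ≡ ones (bit x) n
count≡ones [] = refl
count≡ones {suc n} (true ∷ xs) =
  trans (cong suc (count≡ones xs)) (trans (+-comm 1 _) (sym (ones-shift (bit (true ∷ xs)) n)))
count≡ones {suc n} (false ∷ xs) =
  trans (count≡ones xs) (trans (sym (+-identityʳ _)) (sym (ones-shift (bit (false ∷ xs)) n)))

-- Layer i of the program is the set of states that are Valid at time i, numbered 0 … size i − 1
-- by encode and decode; valid-pred is what makes every vertex reachable.
record EnumeratedAutomaton : Set₁ where
  field
    State  : Set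
    start  : State
    next   : ℕ → State → Bool → State
    Valid  : ℕ → State → Set
    size   : ℕ → ℕ
    encode : ℕ → State → ℕ
    decode : ℕ → ℕ → State
    size-0        : size 0 ≡ 1
    valid-start   : Valid 0 start
    valid-0       : ∀ {s} → Valid 0 s → s ≡ start
    valid-next    : ∀ {i s} x → Valid i s → Valid (suc i) (next i s x)
    valid-pred    : ∀ {i s} → Valid (suc i) s → ∃₂ λ s₀ x → Valid i s₀ × next i s₀ x ≡ s
    encode-<      : ∀ {i s} → Valid i s → encode i s < size i
    decode-encode : ∀ {i s} → Valid i s → decode i (encode i s) ≡ s
    decode-valid  : ∀ {i k} → k < size i → Valid i (decode i k)
    encode-decode : ∀ {i k} → k < size i → encode i (decode i k) ≡ k

  stateAfter : (ℕ → Bool) → ℕ → State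
  stateAfter g zero = start
  stateAfter g (suc i) = next i (stateAfter g i) (g i)

  valid-stateAfter : ∀ g i → Valid i (stateAfter g i)
  valid-stateAfter g zero = valid-start
  valid-stateAfter g (suc i) = valid-next (g i) (valid-stateAfter g i)

  stateAfter-prefix : ∀ {g g′} i → (∀ {j} → j < i → g j ≡ g′ j) → stateAfter g i ≡ stateAfter g′ i
  stateAfter-prefix zero eq = refl
  stateAfter-prefix (suc i) eq =
    cong₂ (next i) (stateAfter-prefix i (λ j<i → eq (m<n⇒m<1+n j<i))) (eq (n<1+n i))

  reachable : ∀ {n} i → i ≤ n → ∀ {s} → Valid i s → Σ (Vec Bool n) λ x → stateAfter (bit x) i ≡ s
  reachable zero _ v = replicate _ false , sym (valid-0 v)
  reachable (suc i) i<n v with valid-pred v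
  ... | s₀ , y , v₀ , refl with reachable i (<⇒≤ i<n) v₀
  ...   | x , refl = setBit x i y ,
    cong₂ (next i) (stateAfter-prefix i (bit-setBit-< x i y)) (bit-setBit x i y i<n)

  layer≡size : ∀ i → layerOf (λ j → size (suc j)) i ≡ size i
  layer≡size zero = sym size-0
  layer≡size (suc i) = refl

  module _ (n : ℕ) (output : State → ℚ) where
    private
      toℕ<size : ∀ {i} (v : Fin (layerOf (λ j → size (suc j)) i)) → toℕ v < size i
      toℕ<size {i} v = subst (toℕ v <_) (layer≡size i) (Fin.toℕ<n v)

    program : ROBP n
    program = record
      { sizes = λ i → size (suc i)
      ; step  = λ i _ v x → fromℕ< (encode-< (valid-next x (decode-valid (toℕ<size v))))
      ; out   = λ v → output (decode n (toℕ v))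
      }

    toℕ-run : ∀ i (i≤n : i ≤ n) x → toℕ (run program i i≤n x) ≡ encode i (stateAfter (bit x) i)
    toℕ-run zero _ x = sym (n<1⇒n≡0 (subst (encode 0 start <_) size-0 (encode-< valid-start)))
    toℕ-run (suc i) i<n x = begin
      toℕ (run program (suc i) i<n x)
        ≡⟨ Fin.toℕ-fromℕ< _ ⟩
      encode (suc i) (next i (decode i (toℕ (run program i (<⇒≤ i<n) x))) (lookup x (fromℕ< i<n)))
        ≡⟨ cong₂ (λ k y → encode (suc i) (next i (decode i k) y))
                 (toℕ-run i (<⇒≤ i<n) x) (lookup≡bit x i i<n) ⟩
      encode (suc i) (next i (decode i (encode i (stateAfter (bit x) i))) (bit x i))
        ≡⟨ cong (λ s → encode (suc i) (next i s (bit x i)))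
                (decode-encode (valid-stateAfter (bit x) i)) ⟩
      encode (suc i) (stateAfter (bit x) (suc i))
        ∎
      where open ≡-Reasoning

    eval-program : ∀ x → eval program x ≡ output (stateAfter (bit x) n)
    eval-program x = cong output (trans (cong (decode n) (toℕ-run n ≤-refl x))
                                        (decode-encode (valid-stateAfter (bit x) n)))

    program-allReachable : AllReachable program
    program-allReachable i i≤n v with reachable i i≤n (decode-valid (toℕ<size v))
    ... | x , eq = x , Fin.toℕ-injective (begin
      toℕ (run program i i≤n x)        ≡⟨ toℕ-run i i≤n x ⟩
      encode i (stateAfter (bit x) i)  ≡⟨ cong (encode i) eq ⟩
      encode i (decode i (toℕ v))      ≡⟨ encode-decode (toℕ<size v) ⟩
      toℕ v                            ∎)
      where open ≡-Reasoning

module BlockCounter (z E : ℕ) (1≤z : 1 ≤ z) (1≤E : 1 ≤ E) where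
  b : ℕ
  b = z + E

  z<b : z < b
  z<b = m<m+n z 1≤E

  1≤b : 1 ≤ b
  1≤b = ≤-trans 1≤z (m≤m+n z E)

  mutual
    endsBlock : ℕ → Bool
    endsBlock i = suc (offset i) ≡ᵇ b

    offset : ℕ → ℕ
    offset zero = 0
    offset (suc i) = if endsBlock i then 0 else suc (offset i)

  blocks : ℕ → ℕ
  blocks zero = 0
  blocks (suc i) = if endsBlock i then suc (blocks i) else blocks i

  -- low c: c zeros so far in the current block, capped at z;
  -- high: some completed block had fewer than z zeros.
  data State : Set where
    high : State
    low  : ℕ → State

  tally : ℕ → Bool → ℕ
  tally c true = c
  tally c false = suc c ⊓ z

  close : ℕ → State
  close c with c <? z
  ... | yes _ = high
  ... | no _  = low 0

  advance : Bool → State → Bool → State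
  advance _     high    _ = high
  advance false (low c) x = low (tally c x)
  advance true  (low c) x = close (tally c x)

  next : ℕ → State → Bool → State
  next i = advance (endsBlock i)

  -- Abstracting endsBlock i with 'with' misses the copies that appear only once next i s x has
  -- reduced, so the case distinction is recorded as equations instead.
  data BlockStep (i : ℕ) : Set where
    boundary : (∀ s x → next i s x ≡ advance true s x) → suc (offset i) ≡ b →
               offset (suc i) ≡ 0 → blocks (suc i) ≡ suc (blocks i) → BlockStep i
    within   : (∀ s x → next i s x ≡ advance false s x) → suc (offset i) ≢ b →
               offset (suc i) ≡ suc (offset i) → blocks (suc i) ≡ blocks i → BlockStep i

  blockStep : ∀ i → BlockStep i
  blockStep i with endsBlock i in e
  ... | true  = boundary (λ s x → cong (λ t → advance t s x) e)
                  (≡ᵇ⇒≡ (suc (offset i)) b (subst T (sym e) tt))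
                  (cong (λ t → if t then 0 else suc (offset i)) e)
                  (cong (λ t → if t then suc (blocks i) else blocks i) e)
  ... | false = within (λ s x → cong (λ t → advance t s x) e)
                  (λ eq → subst T e (≡⇒≡ᵇ (suc (offset i)) b eq))
                  (cong (λ t → if t then 0 else suc (offset i)) e)
                  (cong (λ t → if t then suc (blocks i) else blocks i) e)

  offset<b : ∀ i → offset i < b
  offset<b zero = 1≤b
  offset<b (suc i) with blockStep i
  ... | boundary _ _ o _     = subst (_< b) (sym o) 1≤b
  ... | within   _ ¬last o _ = subst (_< b) (sym o) (≤∧≢⇒< (offset<b i) ¬last)

  blocks*b+offset≡ : ∀ i → blocks i * b + offset i ≡ i
  blocks*b+offset≡ zero = refl
  blocks*b+offset≡ (suc i) with blockStep i
  ... | boundary _ last o bl = begin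
    blocks (suc i) * b + offset (suc i)  ≡⟨ cong₂ (λ k p → k * b + p) bl o ⟩
    suc (blocks i) * b + 0               ≡⟨ +-identityʳ _ ⟩
    b + blocks i * b                     ≡⟨ +-comm b _ ⟩
    blocks i * b + b                     ≡⟨ cong (blocks i * b +_) last ⟨
    blocks i * b + suc (offset i)        ≡⟨ +-suc _ (offset i) ⟩
    suc (blocks i * b + offset i)        ≡⟨ cong suc (blocks*b+offset≡ i) ⟩
    suc i                                ∎
    where open ≡-Reasoning
  ... | within _ _ o bl = begin
    blocks (suc i) * b + offset (suc i)  ≡⟨ cong₂ (λ k p → k * b + p) bl o ⟩
    blocks i * b + suc (offset i)        ≡⟨ +-suc _ (offset i) ⟩
    suc (blocks i * b + offset i)        ≡⟨ cong suc (blocks*b+offset≡ i) ⟩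
    suc i                                ∎
    where open ≡-Reasoning

  ≤-blocks : ∀ {m i} → m * b ≤ i → m ≤ blocks i
  ≤-blocks {m} {i} m*b≤i with m ≤? blocks i
  ... | yes m≤ = m≤
  ... | no m≰  = ⊥-elim (<-irrefl refl (begin-strict
    i                        ≡⟨ blocks*b+offset≡ i ⟨
    blocks i * b + offset i  <⟨ +-monoʳ-< _ (offset<b i) ⟩
    blocks i * b + b         ≡⟨ +-comm _ b ⟩
    suc (blocks i) * b       ≤⟨ *-monoˡ-≤ b (≰⇒> m≰) ⟩
    m * b                    ≤⟨ m*b≤i ⟩
    i                        ∎))
    where open ≤-Reasoning

  within-block : ∀ {s} → offset s ≡ 0 → ∀ j → j < b → offset (s + j) ≡ j × blocks (s + j) ≡ blocks s
  within-block {s} o zero _ =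
    subst (λ t → offset t ≡ 0 × blocks t ≡ blocks s) (sym (+-identityʳ s)) (o , refl)
  within-block {s} o (suc j) j< with within-block {s} o j (<-trans (n<1+n j) j<) | blockStep (s + j)
  ... | oj , _  | boundary _ last _ _ = ⊥-elim (<-irrefl (trans (cong suc (sym oj)) last) j<)
  ... | oj , bj | within _ _ o′ bl    =
    subst (λ t → offset t ≡ suc j × blocks t ≡ blocks s) (sym (+-suc s j)) (trans o′ (cong suc oj) , trans bl bj)

  first-boundary : ∀ {j} → suc j ≡ b → offset (suc j) ≡ 0 × blocks (suc j) ≡ 1
  first-boundary {j} eq with within-block {0} refl j (subst (j <_) eq ≤-refl) | blockStep j
  ... | _  , bj | boundary _ _ o bl  = o , trans bl (cong suc bj)
  ... | oj , _  | within _ ¬last _ _ = ⊥-elim (¬last (trans (cong suc oj) eq))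

  Valid : ℕ → State → Set
  Valid i high = 1 ≤ blocks i
  Valid i (low c) = c ≤ offset i ⊓ z

  valid-0 : ∀ {s} → Valid 0 s → s ≡ low 0
  valid-0 {high} ()
  valid-0 {low c} c≤0 = cong low (n≤0⇒n≡0 c≤0)

  tally-≤ : ∀ {c p} x → c ≤ p ⊓ z → tally c x ≤ suc p ⊓ z
  tally-≤ {p = p} true c≤ = ≤-trans c≤ (⊓-monoˡ-≤ z (n≤1+n p))
  tally-≤ false c≤ = ⊓-monoˡ-≤ z (s≤s (≤-trans c≤ (m⊓n≤m _ z)))

  valid-close : ∀ {i} c → 1 ≤ blocks i → Valid i (close c)
  valid-close c 1≤k with c <? z
  ... | yes _ = 1≤k
  ... | no _  = z≤n

  valid-next : ∀ {i s} x → Valid i s → Valid (suc i) (next i s x)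
  valid-next {i} {high} x v with blockStep i
  ... | boundary _ _ _ bl = subst (1 ≤_) (sym bl) (s≤s z≤n)
  ... | within   _ _ _ bl = subst (1 ≤_) (sym bl) v
  valid-next {i} {low c} x v with blockStep i
  ... | boundary n≡ _ _ bl = subst (Valid (suc i)) (sym (n≡ (low c) x))
                               (valid-close (tally c x) (subst (1 ≤_) (sym bl) (s≤s z≤n)))
  ... | within   n≡ _ o _  = subst (Valid (suc i)) (sym (n≡ (low c) x))
                               (subst (λ p → tally c x ≤ p ⊓ z) (sym o) (tally-≤ x v))

  close-< : ∀ {c} → c < z → close c ≡ high
  close-< {c} c<z with c <? z
  ... | yes _  = refl
  ... | no c≮z = ⊥-elim (c≮z c<z)

  close-z : close z ≡ low 0
  close-z with z <? z
  ... | yes z<z = ⊥-elim (<-irrefl refl z<z)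
  ... | no _    = refl

  valid-pred : ∀ {i s} → Valid (suc i) s → ∃₂ λ s₀ x → Valid i s₀ × next i s₀ x ≡ s
  valid-pred {i} {high} v with blockStep i
  ... | boundary n≡ _ _ _  = low 0 , true , z≤n , trans (n≡ (low 0) true) (close-< 1≤z)
  ... | within   _ _ _ bl  = high , true , subst (1 ≤_) bl v , refl
  valid-pred {i} {low c} v with blockStep i
  ... | boundary n≡ last o _ =
    low z , true , ⊓-glb (m<1+n⇒m≤n (subst (z <_) (sym last) z<b)) ≤-refl ,
    trans (n≡ (low z) true) (trans close-z (cong low (sym (n≤0⇒n≡0 (subst (λ p → c ≤ p ⊓ z) o v)))))
  ... | within   n≡ _ o _  = predecessor c (subst (λ p → c ≤ p ⊓ z) o v)
    where
    predecessor : ∀ c → c ≤ suc (offset i) ⊓ z → ∃₂ λ s₀ x → Valid i s₀ × next i s₀ x ≡ low c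
    predecessor zero _ = low 0 , true , z≤n , n≡ (low 0) true
    predecessor (suc c) c< =
      low c , false ,
      ⊓-glb (≤-pred (≤-trans c< (m⊓n≤m _ z))) (≤-trans (n≤1+n c) (≤-trans c< (m⊓n≤n _ z))) ,
      trans (n≡ (low c) false) (cong low (m≤n⇒m⊓n≡m (≤-trans c< (m⊓n≤n _ z))))

  size : ℕ → ℕ
  size i = suc (offset i ⊓ z) + 1 ⊓ blocks i

  encode : ℕ → State → ℕ
  encode i high = suc (offset i ⊓ z)
  encode i (low c) = c

  decode : ℕ → ℕ → State
  decode i k with k ≟ suc (offset i ⊓ z)
  ... | yes _ = high
  ... | no _  = low k

  encode-< : ∀ {i s} → Valid i s → encode i s < size i
  encode-< {i} {high} v = m<m+n (suc (offset i ⊓ z)) (⊓-glb ≤-refl v)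
  encode-< {i} {low c} v = ≤-trans (s≤s v) (m≤m+n _ _)

  decode-encode : ∀ {i s} → Valid i s → decode i (encode i s) ≡ s
  decode-encode {i} {high} v with suc (offset i ⊓ z) ≟ suc (offset i ⊓ z)
  ... | yes _ = refl
  ... | no ≢r = ⊥-elim (≢r refl)
  decode-encode {i} {low c} v with c ≟ suc (offset i ⊓ z)
  ... | yes refl = ⊥-elim (<-irrefl refl v)
  ... | no _     = refl

  decode-valid : ∀ {i k} → k < size i → Valid i (decode i k)
  decode-valid {i} {k} k< with k ≟ suc (offset i ⊓ z)
  ... | yes refl =
    ≤-trans (+-cancelˡ-< k 0 _ (subst (_< size i) (sym (+-identityʳ k)) k<)) (m⊓n≤n 1 (blocks i))
  ... | no ≢r    = m<1+n⇒m≤n (≤∧≢⇒< k≤suc[r] ≢r)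
    where
    k≤suc[r] : k ≤ suc (offset i ⊓ z)
    k≤suc[r] = m<1+n⇒m≤n (≤-trans k< (≤-trans (+-monoʳ-≤ _ (m⊓n≤m 1 (blocks i)))
                                                (≤-reflexive (+-comm _ 1))))

  encode-decode : ∀ {i k} → k < size i → encode i (decode i k) ≡ k
  encode-decode {i} {k} k< with k ≟ suc (offset i ⊓ z)
  ... | yes refl = refl
  ... | no _     = refl

  size-≤ : ∀ i → size i ≤ suc (suc z)
  size-≤ i = ≤-trans (+-mono-≤ (s≤s (m⊓n≤n (offset i) z)) (m⊓n≤m 1 (blocks i)))
                     (≤-reflexive (+-comm (suc z) 1))

  size-full : size (b + z) ≡ suc (suc z)
  size-full with m≤n⇒∃[o]m+o≡n z<b
  ... | d , eq with first-boundary eq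
  ... | o , bl with within-block {b} (subst (λ t → offset t ≡ 0) eq o) z z<b
  ... | oz , bz = begin
    suc (offset (b + z) ⊓ z) + 1 ⊓ blocks (b + z)
      ≡⟨ cong₂ (λ p k → suc (p ⊓ z) + 1 ⊓ k) oz (trans bz (subst (λ t → blocks t ≡ 1) eq bl)) ⟩
    suc (z ⊓ z) + 1  ≡⟨ cong (λ t → suc t + 1) (⊓-idem z) ⟩
    suc z + 1        ≡⟨ +-comm (suc z) 1 ⟩
    suc (suc z)      ∎
    where open ≡-Reasoning

  automaton : EnumeratedAutomaton
  automaton = record
    { State = State ; start = low 0 ; next = next ; Valid = Valid
    ; size = size ; encode = encode ; decode = decode
    ; size-0 = refl ; valid-start = z≤n ; valid-0 = valid-0
    ; valid-next = valid-next ; valid-pred = valid-pred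
    ; encode-< = encode-< ; decode-encode = decode-encode
    ; decode-valid = decode-valid ; encode-decode = encode-decode
    }

  open EnumeratedAutomaton automaton public using (stateAfter)

  -- An unsaturated counter c < z means the current block so far has offset i − c ones.
  Invariant : (ℕ → Bool) → ℕ → State → Set
  Invariant g i high = suc E ≤ ones g i
  Invariant g i (low c) = z * blocks i + c ≤ zeros g i × (c < z → offset i ≤ ones g i + c)

  -- The right-hand sides are zeros g (suc i) and ones g (suc i) unfolded at x = g i.
  tally-zeros : ∀ {m c Z} x → m + c ≤ Z → m + tally c x ≤ (if x then Z else suc Z)
  tally-zeros true m+c≤Z = m+c≤Z
  tally-zeros {m} {c} {Z} false m+c≤Z =
    ≤-trans (+-monoʳ-≤ m (m⊓n≤m (suc c) z)) (subst (_≤ suc Z) (sym (+-suc m c)) (s≤s m+c≤Z))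

  tally-ones : ∀ {p c O} x → (c < z → p ≤ O + c) → tally c x < z →
               suc p ≤ (if x then suc O else O) + tally c x
  tally-ones true p≤O+c c<z = s≤s (p≤O+c c<z)
  tally-ones {p} {c} {O} false p≤O+c t<z = subst (suc p ≤_) eq (s≤s (p≤O+c c<z))
    where
    suc[c]⊓z≡suc[c] : suc c ⊓ z ≡ suc c
    suc[c]⊓z≡suc[c] with ⊓-sel (suc c) z
    ... | inj₁ eq = eq
    ... | inj₂ eq = ⊥-elim (<-irrefl eq t<z)
    c<z : c < z
    c<z = <-trans (n<1+n c) (subst (_< z) suc[c]⊓z≡suc[c] t<z)
    eq : suc (O + c) ≡ O + suc c ⊓ z
    eq = trans (sym (+-suc O c)) (cong (O +_) (sym suc[c]⊓z≡suc[c]))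

  invariant-close : ∀ g i c → offset (suc i) ≡ 0 → blocks (suc i) ≡ suc (blocks i) →
                    z * blocks i + c ≤ zeros g (suc i) → (c < z → b ≤ ones g (suc i) + c) →
                    Invariant g (suc i) (close c)
  invariant-close g i c o bl zs os with c <? z
  ... | yes c<z = +-cancelˡ-< z E (ones g (suc i)) (begin-strict
    z + E               ≤⟨ os c<z ⟩
    ones g (suc i) + c  <⟨ +-monoʳ-< (ones g (suc i)) c<z ⟩
    ones g (suc i) + z  ≡⟨ +-comm _ z ⟩
    z + ones g (suc i)  ∎)
    where open ≤-Reasoning
  ... | no c≮z  = (begin
    z * blocks (suc i) + 0  ≡⟨ +-identityʳ _ ⟩
    z * blocks (suc i)      ≡⟨ cong (z *_) bl ⟩
    z * suc (blocks i)      ≡⟨ *-suc z (blocks i) ⟩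
    z + z * blocks i        ≤⟨ +-monoˡ-≤ _ (≮⇒≥ c≮z) ⟩
    c + z * blocks i        ≡⟨ +-comm c _ ⟩
    z * blocks i + c        ≤⟨ zs ⟩
    zeros g (suc i)         ∎) , λ _ → subst (_≤ _) (sym o) z≤n
    where open ≤-Reasoning

  invariant-next : ∀ g i s → Invariant g i s → Invariant g (suc i) (next i s (g i))
  invariant-next g i high inv = ≤-trans inv (ones-≤-suc g i)
  invariant-next g i (low c) (zs , os) with blockStep i
  ... | boundary n≡ last o bl = subst (Invariant g (suc i)) (sym (n≡ (low c) (g i)))
    (invariant-close g i (tally c (g i)) o bl (tally-zeros (g i) zs)
      (λ t<z → subst (_≤ ones g (suc i) + tally c (g i)) last (tally-ones (g i) os t<z)))
  ... | within   n≡ _ o bl = subst (Invariant g (suc i)) (sym (n≡ (low c) (g i)))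
    ( subst (λ k → z * k + tally c (g i) ≤ zeros g (suc i)) (sym bl) (tally-zeros (g i) zs)
    , λ t<z → subst (_≤ ones g (suc i) + tally c (g i)) (sym o) (tally-ones (g i) os t<z))

  invariant-stateAfter : ∀ g i → Invariant g i (stateAfter g i)
  invariant-stateAfter g zero = ≤-reflexive (trans (+-identityʳ _) (*-zeroʳ z)) , λ _ → z≤n
  invariant-stateAfter g (suc i) = invariant-next g i _ (invariant-stateAfter g i)

-- A block with more than E = (1 + k) z ones closes as high; blocks have length z + E = (2 + k) z.
record BlockParameters (n z : ℕ) : Set where
  field
    k h F      : ℕ
    blocks-fit : (2 + k) * ((2 + k) * z) ≤ n
    n≡h+h+F    : n ≡ h + h + F
    E≤F        : (1 + k) * z ≤ F
    F≤1+E      : F ≤ suc ((1 + k) * z)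
    F²-large   : 4 * (n * (2 + z)) ≤ 121 * (F * F)

approxCountProgram : ∀ {n z} → 1 ≤ z → (p : BlockParameters n z) →
  Σ (ROBP n) λ P → AllReachable P × HasWidth P (2 + z) ×
                   ComputesApproxCount P (ℕ→ℚ (BlockParameters.h p))
approxCountProgram {n} {z} 1≤z p = program n estimate , program-allReachable n estimate , width , accurate
  where
  open BlockParameters p
  E = (1 + k) * z
  open BlockCounter z E 1≤z (≤-trans 1≤z (m≤n*m z (1 + k)))
  open EnumeratedAutomaton automaton using (program; program-allReachable; eval-program; layer≡size)

  output : State → ℕ
  output high = h + F
  output (low _) = h

  estimate : State → ℚ
  estimate s = ℕ→ℚ (output s)

  width : HasWidth (program n estimate) (2 + z)
  width = (λ i _ → subst (_≤ 2 + z) (sym (layer≡size i)) (size-≤ i))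
        , b + z , ≤-trans (+-monoʳ-≤ b (≤-trans (m≤m+n z E) (m≤m+n b (k * b)))) blocks-fit
        , trans (layer≡size (b + z)) size-full

  output-accurate : ∀ g s → Invariant g n s → ∣ output s - ones g n ∣ ≤ h
  output-accurate g high E<ones = ∣m-n∣≤o
    (subst (h + F ≤_) (+-comm h (ones g n)) (+-monoʳ-≤ h (≤-trans F≤1+E E<ones)))
    (subst (ones g n ≤_) (trans n≡h+h+F (solve 2 (λ h F → h :+ h :+ F := h :+ F :+ h) refl h F))
           (ones≤length g n))
    where open +-*-Solver
  output-accurate g (low c) (zs , _) = ∣m-n∣≤o (m≤n+m h (ones g n))
    (+-cancelʳ-≤ F (ones g n) (h + h) (begin
      ones g n + F          ≤⟨ +-monoʳ-≤ (ones g n) F≤zeros ⟩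
      ones g n + zeros g n  ≡⟨ ones+zeros g n ⟩
      n                     ≡⟨ n≡h+h+F ⟩
      h + h + F             ∎))
    where
    open ≤-Reasoning
    F≤zeros : F ≤ zeros g n
    F≤zeros = begin
      F                 ≤⟨ F≤1+E ⟩
      suc E             ≤⟨ +-monoˡ-≤ E 1≤z ⟩
      b                 ≡⟨ *-comm (2 + k) z ⟩
      z * (2 + k)       ≤⟨ *-monoʳ-≤ z (≤-blocks blocks-fit) ⟩
      z * blocks n      ≤⟨ m≤m+n _ c ⟩
      z * blocks n + c  ≤⟨ zs ⟩
      zeros g n         ∎

  accurate : ComputesApproxCount (program n estimate) (ℕ→ℚ h)
  accurate x = begin
    ℚ.∣ eval (program n estimate) x ℚ.- ℕ→ℚ (count x) ∣
      ≡⟨ cong₂ (λ q m → ℚ.∣ q ℚ.- ℕ→ℚ m ∣) (eval-program n estimate x) (count≡ones x) ⟩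
    ℚ.∣ estimate s ℚ.- ℕ→ℚ (ones (bit x) n) ∣
      ≡⟨ ∣ℕ→ℚ-ℕ→ℚ∣ (output s) (ones (bit x) n) ⟩
    ℕ→ℚ ∣ output s - ones (bit x) n ∣
      ≤⟨ ℕ→ℚ-mono-≤ (output-accurate (bit x) s (invariant-stateAfter (bit x) n)) ⟩
    ℕ→ℚ h
      ∎
    where
    open ℚ.≤-Reasoning
    s = stateAfter (bit x) n

last-true : ∀ {P : ℕ → Set} → (∀ k → Dec (P k)) → P 0 → ∀ d → ¬ P (suc d) → ∃ λ k → P k × ¬ P (suc k)
last-true P? P0 zero ¬P1 = 0 , P0 , ¬P1
last-true P? P0 (suc d) ¬P[2+d] with P? (suc d)
... | yes P[1+d] = suc d , P[1+d] , ¬P[2+d]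
... | no ¬P[1+d] = last-true P? P0 d ¬P[1+d]

4n[2+z]≤121F² : ∀ {n z k F} → 1 ≤ z → n ≤ (3 + k) * (3 + k) * z → (1 + k) * z ≤ F →
                4 * (n * (2 + z)) ≤ 121 * (F * F)
4n[2+z]≤121F² {n} {z} {k} {F} 1≤z n≤ E≤F = begin
  4 * (n * (2 + z))                                ≤⟨ *-monoʳ-≤ 4 n[2+z]≤ ⟩
  4 * (3 * (1 + k) * (3 * (1 + k)) * z * (3 * z))  ≡⟨ solve 2 (λ k z →
      con 4 :* (con 3 :* (con 1 :+ k) :* (con 3 :* (con 1 :+ k)) :* z :* (con 3 :* z))
        := con 108 :* ((con 1 :+ k) :* z :* ((con 1 :+ k) :* z))) refl k z ⟩
  108 * (E * E)                                    ≤⟨ *-monoˡ-≤ (E * E) (m≤m+n 108 13) ⟩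
  121 * (E * E)                                    ≤⟨ *-monoʳ-≤ 121 (*-mono-≤ E≤F E≤F) ⟩
  121 * (F * F)                                    ∎
  where
  open ≤-Reasoning
  open +-*-Solver
  E = (1 + k) * z
  2+z≤3z : 2 + z ≤ 3 * z
  2+z≤3z = ≤-trans (+-monoˡ-≤ z (+-mono-≤ 1≤z 1≤z))
                   (≤-reflexive (solve 1 (λ z → z :+ z :+ z := con 3 :* z) refl z))
  3+k≤3[1+k] : 3 + k ≤ 3 * (1 + k)
  3+k≤3[1+k] = ≤-trans (m≤m+n (3 + k) (k + k))
                       (≤-reflexive (solve 1 (λ k → con 3 :+ k :+ (k :+ k) := con 3 :* (con 1 :+ k)) refl k))
  n[2+z]≤ : n * (2 + z) ≤ 3 * (1 + k) * (3 * (1 + k)) * z * (3 * z)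
  n[2+z]≤ = *-mono-≤ (≤-trans n≤ (*-monoˡ-≤ z (*-mono-≤ 3+k≤3[1+k] 3+k≤3[1+k]))) 2+z≤3z

blockParameters : ∀ {n z} → 1 ≤ z → 4 * z ≤ n → BlockParameters n z
blockParameters {n} {z} 1≤z 4z≤n with last-true (λ k → (2 + k) * (2 + k) * z ≤? n) 4z≤n n ¬fits
  where
  ¬fits : ¬ ((3 + n) * (3 + n) * z ≤ n)
  ¬fits fits = <-irrefl refl (begin-strict
    n                      <⟨ s≤s (m≤n+m n 2) ⟩
    3 + n                  ≤⟨ m≤m*n (3 + n) (3 + n) ⟩
    (3 + n) * (3 + n)      ≡⟨ *-identityʳ ((3 + n) * (3 + n)) ⟨
    (3 + n) * (3 + n) * 1  ≤⟨ *-monoʳ-≤ ((3 + n) * (3 + n)) 1≤z ⟩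
    (3 + n) * (3 + n) * z  ≤⟨ fits ⟩
    n                      ∎)
    where open ≤-Reasoning
... | k , fits , ¬fits′ = record
  { k = k ; h = t / 2 ; F = E + t % 2
  ; blocks-fit = blocks-fit
  ; n≡h+h+F    = n≡h+h+F
  ; E≤F        = m≤m+n E (t % 2)
  ; F≤1+E      = ≤-trans (+-monoʳ-≤ E (m<1+n⇒m≤n (m%n<n t 2))) (≤-reflexive (+-comm E 1))
  ; F²-large   = 4n[2+z]≤121F² {k = k} 1≤z (<⇒≤ (≰⇒> ¬fits′)) (m≤m+n E (t % 2))
  }
  where
  E = (1 + k) * z
  t = n ∸ E
  blocks-fit : (2 + k) * ((2 + k) * z) ≤ n
  blocks-fit = subst (_≤ n) (*-assoc (2 + k) (2 + k) z) fits
  E≤n : E ≤ n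
  E≤n = ≤-trans (m≤n+m E z) (≤-trans (m≤n*m ((2 + k) * z) (2 + k)) blocks-fit)
  n≡h+h+F : n ≡ t / 2 + t / 2 + (E + t % 2)
  n≡h+h+F = begin
    n                            ≡⟨ m+[n∸m]≡n E≤n ⟨
    E + t                        ≡⟨ cong (E +_) (m≡m%n+[m/n]*n t 2) ⟩
    E + (t % 2 + t / 2 * 2)      ≡⟨ solve 3 (λ E r h → E :+ (r :+ h :* con 2) := h :+ h :+ (E :+ r))
                                          refl E (t % 2) (t / 2) ⟩
    t / 2 + t / 2 + (E + t % 2)  ∎
    where
    open ≡-Reasoning
    open +-*-Solver

1/11 : ℚ
1/11 = ℤ.+ 1 ℚ./ 11

sqrtBound-half : ∀ n w h F → n ≡ h + h + F → 4 * (n * w) ≤ 121 * (F * F) → SqrtBound 1/11 n w (ℕ→ℚ h)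
sqrtBound-half n w h F refl 4nw≤121F² =
  subst (λ D → 0ℚ ℚ.≤ D × 1/11 ℚ.* 1/11 ℚ.* ℕ→ℚ n ℚ.* ℕ→ℚ w ℚ.≤ D ℚ.* D) (sym D≡F/2)
    ( ℚ.*-monoʳ-≤-nonNeg ℚ.½ (ℕ→ℚ-mono-≤ {0} {F} z≤n)
    , subst₂ ℚ._≤_ (sym c²nw≡) (sym [F/2]²≡) (ℚ.*-monoʳ-≤-nonNeg 1/484 (ℕ→ℚ-mono-≤ 4nw≤121F²)))
  where
  open ℚ-Solver.+-*-Solver
  1/484 = ℤ.+ 1 ℚ./ 484
  D≡F/2 : ℕ→ℚ (h + h + F) ℚ.* ℚ.½ ℚ.- ℕ→ℚ h ≡ ℕ→ℚ F ℚ.* ℚ.½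
  D≡F/2 rewrite ℕ→ℚ-+ (h + h) F | ℕ→ℚ-+ h h =
    solve 2 (λ h f → (h :+ h :+ f) :* con ℚ.½ :- h := f :* con ℚ.½) refl (ℕ→ℚ h) (ℕ→ℚ F)
  c²nw≡ : 1/11 ℚ.* 1/11 ℚ.* ℕ→ℚ n ℚ.* ℕ→ℚ w ≡ ℕ→ℚ (4 * (n * w)) ℚ.* 1/484
  c²nw≡ rewrite ℕ→ℚ-* 4 (n * w) | ℕ→ℚ-* n w =
    solve 2 (λ n w → con 1/11 :* con 1/11 :* n :* w := con (ℕ→ℚ 4) :* (n :* w) :* con 1/484)
            refl (ℕ→ℚ n) (ℕ→ℚ w)
  [F/2]²≡ : ℕ→ℚ F ℚ.* ℚ.½ ℚ.* (ℕ→ℚ F ℚ.* ℚ.½) ≡ ℕ→ℚ (121 * (F * F)) ℚ.* 1/484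
  [F/2]²≡ rewrite ℕ→ℚ-* 121 (F * F) | ℕ→ℚ-* F F =
    solve 1 (λ f → f :* con ℚ.½ :* (f :* con ℚ.½) := con (ℕ→ℚ 121) :* (f :* f) :* con 1/484)
            refl (ℕ→ℚ F)

theorem6p1 : Σ ℚ λ c → 0ℚ ℚ.< c ×
    (∀ (n w : ℕ) → 1 ≤ n → 3 ≤ w → 10 * w ≤ n →
    Σ (ROBP n) λ P → AllReachable P × HasWidth P w ×
    Σ ℚ λ Δ → ComputesApproxCount P Δ × SqrtBound c n w Δ)
theorem6p1 = 1/11 , ℚ.positive⁻¹ 1/11 , construction
  where
  construction : ∀ (n w : ℕ) → 1 ≤ n → 3 ≤ w → 10 * w ≤ n →
    Σ (ROBP n) λ P → AllReachable P × HasWidth P w ×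
    Σ ℚ λ Δ → ComputesApproxCount P Δ × SqrtBound 1/11 n w Δ
  construction n w _ (s≤s (s≤s (s≤s {n = y} _))) 10w≤n =
    let P , reachable , width , accurate = approxCountProgram (s≤s z≤n) parameters
    in  P , reachable , width , ℕ→ℚ h , accurate , sqrtBound-half n w h F n≡h+h+F F²-large
    where
    parameters : BlockParameters n (suc y)
    parameters = blockParameters (s≤s z≤n)
                   (≤-trans (*-mono-≤ {4} {10} (m≤m+n 4 6) (m≤n+m (suc y) 2)) 10w≤n)
    open BlockParameters parameters
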